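{- Let $G_1,G_2$ be finite abelian groups with $|G_2|=|G_1|+1=n$, where $n\geqslant 3$, let $\varphi:G_1\to G_2$ be a map and let $D=\{(i,\varphi(i)) : i\in G_1\}\subseteq G_1\times G_2$. Then $D$ is a direct product difference set of order $n$ in $G_1\times G_2$ if and only if $\varphi$ is a circular Costas map.
   Context: Let $G=A\times B$ be a direct product of groups written additively, with $|A|=n-1$ and $|B|=n$, $n\geqslant 3$. A subset $D\subseteq G$ is a direct product difference set of order $n$ in $G$ if every element of $G\setminus\big((A\times\{0\})\cup(\{0\}\times B)\big)$ can be written in exactly one way as $d_j-d_i$ with $d_i,d_j\in D$, and no nonidentity element of $(A\times\{0\})\cup(\{0\}\times B)$ can be written as such a difference. For finite abelian groups $G_1,G_2$ with $|G_1|+1=|G_2|$, a map $\varphi:G_1\to G_2$ is circular Costas if $\varphi$ is injective and, for every $k\in G_1\setminus\{0\}$, the map $i\mapsto\varphi(i+k)-\varphi(i)$ from $G_1$ to $G_2$ is injective. -}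

module Defs where

open import Level using (Level; _⊔_)
open import Data.Nat using (ℕ; _∸_; _≤_)
open import Data.Fin using (Fin)
open import Data.Product using (_×_; _,_; ∃-syntax; Σ-syntax)
open import Data.Sum using (_⊎_)
open import Relation.Nullary using (¬_)
open import Relation.Binary.PropositionalEquality as P using ()
open import Function.Bundles using (Bijection; Func)
open import Algebra.Bundles using (AbelianGroup)

private variable c ℓ c₁ ℓ₁ c₂ ℓ₂ : Level

HasCard : AbelianGroup c ℓ → ℕ → Set _
HasCard G m = Bijection (AbelianGroup.setoid G) (P.setoid (Fin m))

Subset : ∀ {a} → Set a → (p : Level) → Set _
Subset A p = A → Set p

module DirectProduct (A : AbelianGroup c₁ ℓ₁) (B : AbelianGroup c₂ ℓ₂) where
  module A = AbelianGroup A
  module B = AbelianGroup B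

  -- carrier of A × B (groups written additively: _∙_ is +, _⁻¹ is negation, ε is 0)
  Carrier : Set (c₁ ⊔ c₂)
  Carrier = A.Carrier × B.Carrier

  _≈_ : Carrier → Carrier → Set (ℓ₁ ⊔ ℓ₂)
  (a , b) ≈ (a' , b') = (a A.≈ a') × (b B.≈ b')

  0G : Carrier
  0G = A.ε , B.ε

  _-_ : Carrier → Carrier → Carrier
  (a , b) - (a' , b') = (a A.∙ (a' A.⁻¹)) , (b B.∙ (b' B.⁻¹))

  InAxes : Carrier → Set (ℓ₁ ⊔ ℓ₂)
  InAxes (a , b) = (b B.≈ B.ε) ⊎ (a A.≈ A.ε)

  IsDPDS : ∀ {p} → ℕ → Subset Carrier p → Set _
  IsDPDS n D =
      HasCard A (n ∸ 1) × HasCard B n × 3 ≤ n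
    × (∀ g → ¬ InAxes g →
         (∃[ di ] ∃[ dj ] (D di × D dj × (dj - di) ≈ g))
       × (∀ di dj ei ej → D di → D dj → D ei → D ej →
            (dj - di) ≈ g → (ej - ei) ≈ g → (di ≈ ei × dj ≈ ej)))
    × (∀ di dj → D di → D dj → InAxes (dj - di) → (dj - di) ≈ 0G)

IsCircularCostas : (G₁ : AbelianGroup c₁ ℓ₁) (G₂ : AbelianGroup c₂ ℓ₂) →
  Func (AbelianGroup.setoid G₁) (AbelianGroup.setoid G₂) → Set _
IsCircularCostas G₁ G₂ φ =
    (∀ i j → f i ≈₂ f j → i ≈₁ j)
  × (∀ k → ¬ (k ≈₁ ε₁) → ∀ i j →
       (f (i +₁ k) -₂ f i) ≈₂ (f (j +₁ k) -₂ f j) → i ≈₁ j)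
  where
  open AbelianGroup G₁ using () renaming (_≈_ to _≈₁_; _∙_ to _+₁_; ε to ε₁)
  open AbelianGroup G₂ using () renaming (_≈_ to _≈₂_; _∙_ to _+₂_; _⁻¹ to -₂_)
  f = Func.to φ
  _-₂_ : _ → _ → _
  x -₂ y = x +₂ (-₂ y)

Graph : (G₁ : AbelianGroup c₁ ℓ₁) (G₂ : AbelianGroup c₂ ℓ₂) →
  Func (AbelianGroup.setoid G₁) (AbelianGroup.setoid G₂) →
  Subset (AbelianGroup.Carrier G₁ × AbelianGroup.Carrier G₂) (c₁ ⊔ ℓ₁ ⊔ ℓ₂)
Graph G₁ G₂ φ (x , y) = Σ[ i ∈ AbelianGroup.Carrier G₁ ] ((x , y) ≈ (i , Func.to φ i))
  where open DirectProduct G₁ G₂ using (_≈_)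

{-# OPTIONS --safe #-}
-- For k ≠ 0 the differences of graph points with first coordinate k are the
-- values of Δₖ i = φ (i + k) − φ i, and the difference-set axioms translate
-- directly: uniqueness of representations is injectivity of each Δₖ, and the
-- axis condition is injectivity of φ. The only counting step is existence:
-- Δₖ is an injection from the (n − 1)-element group G₁ into the n-element
-- group G₂ that misses 0, so it hits every nonzero element.
module Submission where

open import Defs
open import Level using (Level; _⊔_)
open import Data.Nat using (ℕ; suc; _≤_; _∸_; s≤s)
open import Data.Nat.Properties using (n<1+n)
open import Data.Fin using (Fin; zero; suc; punchOut)
open import Data.Fin.Properties using (any?; _≟_; punchOut-injective; <⇒notInjective)
open import Data.Product using (_×_; _,_; proj₁; proj₂; ∃-syntax)
open import Data.Sum using (inj₁; inj₂)
open import Relation.Nullary using (¬_; yes; no; contradiction)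
open import Relation.Binary.Bundles using (Setoid)
open import Relation.Binary.PropositionalEquality as ≡ using (_≡_; _≢_; refl)
open import Function using (_∘_)
open import Function.Bundles using (Func; _⇔_; mk⇔; Bijection)
open import Function.Definitions using (Injective)
open import Algebra.Bundles using (AbelianGroup)
open import Data.Product.Relation.Binary.Pointwise.NonDependent using (_×ₛ_)
import Algebra.Properties.AbelianGroup as AbelianGroupProperties
import Algebra.Properties.Group as GroupProperties

injective⇒hitsAllBut : ∀ {m} {h : Fin m → Fin (suc m)} → Injective _≡_ _≡_ h →
  ∀ {p q} → (∀ t → h t ≢ p) → q ≢ p → ∃[ t ] h t ≡ q
injective⇒hitsAllBut {m} {h} h-injective {p} {q} h-avoids q≢p with any? (λ t → h t ≟ q)
... | yes hit = hit
-- were q missed, prepending q to h and punching out p would inject Fin (suc m) into Fin m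
... | no miss = contradiction (λ {t u} → squeeze-injective {t} {u}) (<⇒notInjective (n<1+n m))
  where
  extend : Fin (suc m) → Fin (suc m)
  extend zero    = q
  extend (suc t) = h t

  extend-avoids : ∀ t → p ≢ extend t
  extend-avoids zero    = q≢p ∘ ≡.sym
  extend-avoids (suc t) = h-avoids t ∘ ≡.sym

  extend-injective : Injective _≡_ _≡_ extend
  extend-injective {zero}  {zero}  _  = refl
  extend-injective {zero}  {suc u} eq = contradiction (u , ≡.sym eq) miss
  extend-injective {suc t} {zero}  eq = contradiction (t , eq) miss
  extend-injective {suc t} {suc u} eq = ≡.cong suc (h-injective eq)

  squeeze : Fin (suc m) → Fin m
  squeeze t = punchOut (extend-avoids t)

  squeeze-injective : Injective _≡_ _≡_ squeeze
  squeeze-injective {t} {u} = extend-injective ∘ punchOut-injective (extend-avoids t) (extend-avoids u)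

module _ {a ℓa b ℓb} {S : Setoid a ℓa} {T : Setoid b ℓb} where
  private
    module S = Setoid S
    module T = Setoid T

  card-injective⇒hitsAllBut : ∀ {m} →
    Bijection S (≡.setoid (Fin m)) → Bijection T (≡.setoid (Fin (suc m))) →
    ∀ {h : S.Carrier → T.Carrier} → Injective S._≈_ T._≈_ h →
    ∀ {p q} → (∀ s → ¬ h s T.≈ p) → ¬ q T.≈ p → ∃[ s ] h s T.≈ q
  card-injective⇒hitsAllBut {m} σ τ {h} h-injective {p} {q} h-avoids q≉p =
    σ⁻ (proj₁ hit) , τ.injective (proj₂ hit)
    where
    module σ = Bijection σ
    module τ = Bijection τ

    σ⁻ : Fin m → S.Carrier
    σ⁻ t = proj₁ (σ.strictlySurjective t)

    hᶠ : Fin m → Fin (suc m)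
    hᶠ t = τ.to (h (σ⁻ t))

    hᶠ-injective : Injective _≡_ _≡_ hᶠ
    hᶠ-injective {t} {u} eq = begin
      t              ≡⟨ proj₂ (σ.strictlySurjective t) ⟨
      σ.to (σ⁻ t)    ≡⟨ σ.cong (h-injective (τ.injective eq)) ⟩
      σ.to (σ⁻ u)    ≡⟨ proj₂ (σ.strictlySurjective u) ⟩
      u              ∎
      where open ≡.≡-Reasoning

    hᶠ-avoids : ∀ t → hᶠ t ≢ τ.to p
    hᶠ-avoids t = h-avoids (σ⁻ t) ∘ τ.injective

    hit : ∃[ t ] hᶠ t ≡ τ.to q
    hit = injective⇒hitsAllBut hᶠ-injective hᶠ-avoids (q≉p ∘ τ.injective)

module _ {c ℓ} (G : AbelianGroup c ℓ) where
  open AbelianGroup G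
  open import Relation.Binary.Reasoning.Setoid setoid

  x-y≈z⇒x≈y∙z : ∀ {x y z} → x - y ≈ z → x ≈ y ∙ z
  x-y≈z⇒x≈y∙z {x} {y} {z} eq = begin
    x            ≈⟨ xyx⁻¹≈y y x ⟨
    y ∙ x - y    ≈⟨ assoc y x (y ⁻¹) ⟩
    y ∙ (x - y)  ≈⟨ ∙-congˡ eq ⟩
    y ∙ z        ∎
    where open AbelianGroupProperties G using (xyx⁻¹≈y)

module GraphDifferences {c₁ ℓ₁ c₂ ℓ₂}
  (G₁ : AbelianGroup c₁ ℓ₁) (G₂ : AbelianGroup c₂ ℓ₂)
  (φ : Func (AbelianGroup.setoid G₁) (AbelianGroup.setoid G₂)) where
  private
    module A = AbelianGroup G₁
    module B = AbelianGroup G₂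
    module Aᴾ = GroupProperties A.group
    module Bᴾ = GroupProperties B.group
    module Dₛ = Setoid (A.setoid ×ₛ B.setoid)
  open DirectProduct G₁ G₂ using (Carrier; InAxes; 0G) renaming (_≈_ to infix 4 _≈ᴰ_; _-_ to infixl 6 _-ᴰ_)
  open AbelianGroupProperties G₁ using (xyx⁻¹≈y)

  f : A.Carrier → B.Carrier
  f = Func.to φ

  D : Carrier → Set (c₁ ⊔ ℓ₁ ⊔ ℓ₂)
  D = Graph G₁ G₂ φ

  point : A.Carrier → Carrier
  point i = i , f i

  point∈D : ∀ i → D (point i)
  point∈D i = i , A.refl , B.refl

  point-cong : ∀ {i j} → i A.≈ j → point i ≈ᴰ point j
  point-cong i≈j = i≈j , Func.cong φ i≈j

  Δ : A.Carrier → A.Carrier → B.Carrier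
  Δ k i = f (i A.∙ k) B.- f i

  point-diff : ∀ k i → point (i A.∙ k) -ᴰ point i ≈ᴰ (k , Δ k i)
  point-diff k i = xyx⁻¹≈y i k , B.refl

  Injectiveᶠ : Set (c₁ ⊔ ℓ₁ ⊔ ℓ₂)
  Injectiveᶠ = ∀ i j → f i B.≈ f j → i A.≈ j

  DifferencesInjective : Set (c₁ ⊔ ℓ₁ ⊔ ℓ₂)
  DifferencesInjective = ∀ k → ¬ k A.≈ A.ε → ∀ i j → Δ k i B.≈ Δ k j → i A.≈ j

  Represented : Carrier → Set (c₁ ⊔ c₂ ⊔ ℓ₁ ⊔ ℓ₂)
  Represented g = ∃[ di ] ∃[ dj ] (D di × D dj × (dj -ᴰ di) ≈ᴰ g)

  RepresentedAtMostOnce : Carrier → Set (c₁ ⊔ c₂ ⊔ ℓ₁ ⊔ ℓ₂)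
  RepresentedAtMostOnce g = ∀ di dj ei ej → D di → D dj → D ei → D ej →
    (dj -ᴰ di) ≈ᴰ g → (ej -ᴰ ei) ≈ᴰ g → (di ≈ᴰ ei × dj ≈ᴰ ej)

  AxisCondition : Set (c₁ ⊔ c₂ ⊔ ℓ₁ ⊔ ℓ₂)
  AxisCondition = ∀ di dj → D di → D dj → InAxes (dj -ᴰ di) → (dj -ᴰ di) ≈ᴰ 0G

  Δ≉ε : Injectiveᶠ → ∀ {k} → ¬ k A.≈ A.ε → ∀ i → ¬ Δ k i B.≈ B.ε
  Δ≉ε f-injective k≉ε i Δki≈ε =
    k≉ε (Aᴾ.identityʳ-unique i _ (f-injective _ _ (Bᴾ.x∙y⁻¹≈ε⇒x≈y _ _ Δki≈ε)))

  InAxes-resp : ∀ {g h} → g ≈ᴰ h → InAxes g → InAxes h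
  InAxes-resp (_ , b≈b′) (inj₁ b≈ε) = inj₁ (B.trans (B.sym b≈b′) b≈ε)
  InAxes-resp (a≈a′ , _) (inj₂ a≈ε) = inj₂ (A.trans (A.sym a≈a′) a≈ε)

  -ᴰ-cong : ∀ {d d′ e e′} → d ≈ᴰ d′ → e ≈ᴰ e′ → e -ᴰ d ≈ᴰ e′ -ᴰ d′
  -ᴰ-cong (a≈a′ , b≈b′) (c≈c′ , d≈d′) = Aᴾ.//-cong₂ c≈c′ a≈a′ , Bᴾ.//-cong₂ d≈d′ b≈b′

  representation⇒Δ : ∀ {k b d e} → D d → D e → e -ᴰ d ≈ᴰ (k , b) →
    ∃[ i ] (d ≈ᴰ point i × e ≈ᴰ point (i A.∙ k) × Δ k i B.≈ b)
  representation⇒Δ {k} {b} (i , d≈i) (j , e≈j) e-d≈kb =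
    i , d≈i , Dₛ.trans e≈j (point-cong j≈i+k) , Δki≈b
    where
    j-i≈kb : point j -ᴰ point i ≈ᴰ (k , b)
    j-i≈kb = Dₛ.trans (-ᴰ-cong (Dₛ.sym d≈i) (Dₛ.sym e≈j)) e-d≈kb
    j≈i+k : j A.≈ i A.∙ k
    j≈i+k = x-y≈z⇒x≈y∙z G₁ (proj₁ j-i≈kb)
    Δki≈b : Δ k i B.≈ b
    Δki≈b = B.trans (Bᴾ.//-cong₂ (Func.cong φ (A.sym j≈i+k)) B.refl) (proj₂ j-i≈kb)

  axisCondition⇒injective : AxisCondition → Injectiveᶠ
  axisCondition⇒injective axes i j fi≈fj = A.sym (Aᴾ.x∙y⁻¹≈ε⇒x≈y j i j-i≈ε)
    where
    j-i≈ε : j A.- i A.≈ A.ε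
    j-i≈ε = proj₁ (axes (point i) (point j) (point∈D i) (point∈D j)
                        (inj₁ (Bᴾ.x≈y⇒x∙y⁻¹≈ε (B.sym fi≈fj))))

  atMostOnce⇒differencesInjective : Injectiveᶠ →
    (∀ g → ¬ InAxes g → RepresentedAtMostOnce g) → DifferencesInjective
  atMostOnce⇒differencesInjective f-injective at-most-once k k≉ε i j Δki≈Δkj =
    proj₁ (proj₁ (at-most-once (k , Δ k i) off-axes
      (point i) (point (i A.∙ k)) (point j) (point (j A.∙ k))
      (point∈D _) (point∈D _) (point∈D _) (point∈D _)
      (point-diff k i) (Dₛ.trans (point-diff k j) (A.refl , B.sym Δki≈Δkj))))
    where
    off-axes : ¬ InAxes (k , Δ k i)
    off-axes (inj₁ Δki≈ε) = Δ≉ε f-injective k≉ε i Δki≈ε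
    off-axes (inj₂ k≈ε)   = k≉ε k≈ε

  injective⇒axisCondition : Injectiveᶠ → AxisCondition
  injective⇒axisCondition f-injective d e (i , d≈i) (j , e≈j) on-axes =
    Aᴾ.x≈y⇒x∙y⁻¹≈ε (proj₁ e≈d) , Bᴾ.x≈y⇒x∙y⁻¹≈ε (proj₂ e≈d)
    where
    j≈i : j A.≈ i
    j≈i with InAxes-resp (-ᴰ-cong d≈i e≈j) on-axes
    ... | inj₁ fj-fi≈ε = f-injective j i (Bᴾ.x∙y⁻¹≈ε⇒x≈y _ _ fj-fi≈ε)
    ... | inj₂ j-i≈ε   = Aᴾ.x∙y⁻¹≈ε⇒x≈y _ _ j-i≈ε

    e≈d : e ≈ᴰ d
    e≈d = Dₛ.trans e≈j (Dₛ.trans (point-cong j≈i) (Dₛ.sym d≈i))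

  differencesInjective⇒atMostOnce : DifferencesInjective →
    ∀ g → ¬ InAxes g → RepresentedAtMostOnce g
  differencesInjective⇒atMostOnce Δ-injective (k , b) off-axes d e d′ e′ d∈ e∈ d′∈ e′∈ e-d≈g e′-d′≈g
    with i  , d≈i  , e≈i+k  , Δki≈b  ← representation⇒Δ d∈ e∈ e-d≈g
       | i′ , d′≈i′ , e′≈i′+k , Δki′≈b ← representation⇒Δ d′∈ e′∈ e′-d′≈g
    = let i≈i′ = Δ-injective k (off-axes ∘ inj₂) i i′ (B.trans Δki≈b (B.sym Δki′≈b)) in
      Dₛ.trans d≈i (Dₛ.trans (point-cong i≈i′) (Dₛ.sym d′≈i′))
    , Dₛ.trans e≈i+k (Dₛ.trans (point-cong (A.∙-congʳ i≈i′)) (Dₛ.sym e′≈i′+k))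

  card⇒represented : ∀ {m} → HasCard G₁ m → HasCard G₂ (suc m) →
    Injectiveᶠ → DifferencesInjective → ∀ g → ¬ InAxes g → Represented g
  card⇒represented |G₁| |G₂| f-injective Δ-injective (k , b) off-axes =
    point i , point (i A.∙ k) , point∈D _ , point∈D _ ,
    Dₛ.trans (point-diff k i) (A.refl , Δki≈b)
    where
    k≉ε : ¬ k A.≈ A.ε
    k≉ε = off-axes ∘ inj₂

    hit : ∃[ i ] Δ k i B.≈ b
    hit = card-injective⇒hitsAllBut |G₁| |G₂| (λ {i} {j} → Δ-injective k k≉ε i j)
            (Δ≉ε f-injective k≉ε) (off-axes ∘ inj₁)

    i : A.Carrier
    i = proj₁ hit

    Δki≈b : Δ k i B.≈ b
    Δki≈b = proj₂ hit

theorem4p4 : ∀ {c₁ ℓ₁ c₂ ℓ₂ : Level}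
    (G₁ : AbelianGroup c₁ ℓ₁) (G₂ : AbelianGroup c₂ ℓ₂) (n : ℕ) →
    3 ≤ n → HasCard G₂ n → HasCard G₁ (n ∸ 1) →
    (φ : Func (AbelianGroup.setoid G₁) (AbelianGroup.setoid G₂)) →
    DirectProduct.IsDPDS G₁ G₂ n (Graph G₁ G₂ φ) ⇔ IsCircularCostas G₁ G₂ φ
theorem4p4 G₁ G₂ (suc m) 3≤n@(s≤s _) |G₂| |G₁| φ = mk⇔ dpds⇒costas costas⇒dpds
  where
  open GraphDifferences G₁ G₂ φ

  dpds⇒costas : DirectProduct.IsDPDS G₁ G₂ (suc m) D → IsCircularCostas G₁ G₂ φ
  dpds⇒costas (_ , _ , _ , representations , axes) =
    f-injective , atMostOnce⇒differencesInjective f-injective (λ g → proj₂ ∘ representations g)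
    where
    f-injective : Injectiveᶠ
    f-injective = axisCondition⇒injective axes

  costas⇒dpds : IsCircularCostas G₁ G₂ φ → DirectProduct.IsDPDS G₁ G₂ (suc m) D
  costas⇒dpds (f-injective , Δ-injective) =
    |G₁| , |G₂| , 3≤n ,
    (λ g off-axes → card⇒represented |G₁| |G₂| f-injective Δ-injective g off-axes
                  , differencesInjective⇒atMostOnce Δ-injective g off-axes) ,
    injective⇒axisCondition f-injective
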